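{- Let $q$ be a positive integer and let $S=\langle n,n+1,\dots,n+t\rangle$ with integers $1\leq t<n$. Then $$GM_q(S)=1+\sum_{k=0}^{n-1}\min_{1\leq i\leq t}\{q,\ C_{k,i}\},$$ where $k_i=(k-iq)\bmod n$ and $C_{k,i}:=q-\left\lceil\frac{k}{t}\right\rceil+\left\lceil\frac{k_i}{t}\right\rceil+\left\lceil\frac{iq-k}{n}\right\rceil$, and for each $k$ the minimum is over the set consisting of $q$ together with $C_{k,i}$ for $1\leq i\leq t$.
   Context: $\langle n,\dots,n+t\rangle$ is the set of $\mathbb N$-linear combinations of $n,\dots,n+t$. For integers $a$ and $b\geq1$, $a\bmod b$ denotes the remainder in $\{0,\dots,b-1\}$. Write $S^*=S\setminus\{0\}$, $qS^*+S=\{qx+y: x\in S^*,\ y\in S\}$, and $GM_q(S):=\#\big(S\setminus (qS^*+S)\big)+1$. -}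

module Defs where

open import Data.Nat as ℕ using (ℕ; zero; suc; NonZero)
open import Data.Integer as ℤ using (ℤ; +_; -_; _⊓_; _/ℕ_; _%ℕ_)
open import Data.Fin using (Fin; toℕ)
open import Data.Product using (Σ; ∃; _×_)
open import Relation.Binary.PropositionalEquality using (_≡_; _≢_)
open import Relation.Nullary using (¬_)

sumFin : (m : ℕ) → (Fin m → ℕ) → ℕ
sumFin zero    f = 0
sumFin (suc m) f = f Fin.zero ℕ.+ sumFin m (λ j → f (Fin.suc j))
  where import Data.Fin as Fin

InS : (n t m : ℕ) → Set
InS n t m = Σ (Fin (suc t) → ℕ) λ c → m ≡ sumFin (suc t) (λ j → c j ℕ.* (n ℕ.+ toℕ j))

InQSS : (q n t m : ℕ) → Set
InQSS q n t m = ∃ λ x → ∃ λ y → InS n t x × x ≢ 0 × InS n t y × m ≡ q ℕ.* x ℕ.+ y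

InGM : (q n t m : ℕ) → Set
InGM q n t m = InS n t m × ¬ InQSS q n t m

ceilDiv : ℤ → (d : ℕ) → .{{NonZero d}} → ℤ
ceilDiv a d = - ((- a) /ℕ d)

C : (q n t k i : ℕ) → .{{NonZero n}} → .{{NonZero t}} → ℤ
C q n t k i =
  + q ℤ.- ceilDiv (+ k) t
      ℤ.+ ceilDiv (+ ((+ k ℤ.- + (i ℕ.* q)) %ℕ n)) t
      ℤ.+ ceilDiv (+ (i ℕ.* q) ℤ.- + k) n

minOver : ℕ → (ℕ → ℤ) → ℕ → ℤ
minOver q f zero    = + q
minOver q f (suc j) = minOver q f j ⊓ f (suc j)

sumℤ : ℕ → (ℕ → ℤ) → ℤ
sumℤ zero    f = + 0
sumℤ (suc m) f = sumℤ m f ℤ.+ f m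

-- S = ⟨n, …, n+t⟩ is the union of the intervals [s n, s (n + t)], so for a residue k < n
-- the element a n + k lies in S iff a ≥ ⌈k/t⌉.  Since qS ⊆ S, qS* + S is the union of the
-- translates q (n + i) + S, 0 ≤ i ≤ t, and a n + k - q (n + i) = (a - q + ⌊(k - iq)/n⌋) n + kᵢ;
-- hence a n + k ∈ q (n + i) + S iff a - ⌈k/t⌉ ≥ C_{k,i}, where C_{k,0} = q.  So in the residue
-- class of k the elements of S ∖ (qS* + S) are the a n + k with 0 ≤ a - ⌈k/t⌉ < min {q, C_{k,i}},
-- and summing over k counts them.

module Submission where

open import Defs
open import Data.Nat as ℕ using (ℕ; zero; suc; NonZero; z≤n; s≤s)
import Data.Nat.Properties as ℕₚ
open import Data.Integer as ℤ using (ℤ)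
import Data.Integer.Properties as ℤₚ
open import Data.Fin as Fin using (Fin; toℕ; fromℕ<)
open import Data.Fin.Properties using (toℕ<n; toℕ-fromℕ<)
open import Data.List using (List; []; _++_; applyUpTo; length)
open import Data.List.Membership.Propositional using (_∈_)
open import Data.List.Relation.Unary.Unique.Propositional using (Unique)
open import Data.Product using (Σ; ∃; _×_; _,_; proj₁; proj₂)
open import Data.Sum using (_⊎_; inj₁; inj₂)
open import Data.Empty using (⊥; ⊥-elim)
open import Function using (_∘_)
open import Function.Bundles using (_⇔_; mk⇔; Equivalence)
import Function.Properties.Equivalence as ⇔
open import Relation.Binary.PropositionalEquality
open import Relation.Nullary using (¬_; yes; no; contradiction)

module _ where
  open import Data.Nat using (_+_; _*_; _∸_; _≤_; _<_; _≤?_; ≢-nonZero⁻¹)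
  open ℕₚ
  open import Algebra.Properties.CommutativeSemigroup +-commutativeSemigroup using (interchange)
  open import Data.Nat.Tactic.RingSolver using (solve-∀)

  sumFin-cong : ∀ m {f g : Fin m → ℕ} → (∀ j → f j ≡ g j) → sumFin m f ≡ sumFin m g
  sumFin-cong zero    f≗g = refl
  sumFin-cong (suc m) f≗g = cong₂ _+_ (f≗g Fin.zero) (sumFin-cong m (f≗g ∘ Fin.suc))

  sumFin-+ : ∀ m (f g : Fin m → ℕ) → sumFin m (λ j → f j + g j) ≡ sumFin m f + sumFin m g
  sumFin-+ zero    f g = refl
  sumFin-+ (suc m) f g =
    trans (cong (f Fin.zero + g Fin.zero +_) (sumFin-+ m (f ∘ Fin.suc) (g ∘ Fin.suc)))
          (interchange (f Fin.zero) (g Fin.zero) _ _)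

  sumFin-*ʳ : ∀ m (f : Fin m → ℕ) c → sumFin m (λ j → f j * c) ≡ sumFin m f * c
  sumFin-*ʳ zero    f c = refl
  sumFin-*ʳ (suc m) f c =
    trans (cong (f Fin.zero * c +_) (sumFin-*ʳ m (f ∘ Fin.suc) c))
          (sym (*-distribʳ-+ c (f Fin.zero) _))

  sumFin-mono-≤ : ∀ m {f g : Fin m → ℕ} → (∀ j → f j ≤ g j) → sumFin m f ≤ sumFin m g
  sumFin-mono-≤ zero    f≤g = z≤n
  sumFin-mono-≤ (suc m) f≤g = +-mono-≤ (f≤g Fin.zero) (sumFin-mono-≤ m (f≤g ∘ Fin.suc))

  sumFin-zero : ∀ m → sumFin m (λ _ → 0) ≡ 0
  sumFin-zero zero    = refl
  sumFin-zero (suc m) = sumFin-zero m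

  kronecker : ∀ {m} → Fin m → Fin m → ℕ
  kronecker Fin.zero    Fin.zero    = 1
  kronecker Fin.zero    (Fin.suc _) = 0
  kronecker (Fin.suc _) Fin.zero    = 0
  kronecker (Fin.suc i) (Fin.suc j) = kronecker i j

  sumFin-kronecker : ∀ m (i : Fin m) (w : Fin m → ℕ) → sumFin m (λ j → kronecker i j * w j) ≡ w i
  sumFin-kronecker (suc m) Fin.zero    w =
    trans (cong (w Fin.zero + 0 +_) (sumFin-zero m)) (trans (+-identityʳ _) (+-identityʳ _))
  sumFin-kronecker (suc m) (Fin.suc i) w = sumFin-kronecker m i (w ∘ Fin.suc)

  InIntervals : (n t x : ℕ) → Set
  InIntervals n t x = ∃ λ s → s * n ≤ x × x ≤ s * (n + t)

  module _ {n t : ℕ} where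

    InS⇒InIntervals : ∀ {x} → InS n t x → InIntervals n t x
    InS⇒InIntervals (c , refl) = sumFin (suc t) c , lower , upper
      where
      x = sumFin (suc t) (λ j → c j * (n + toℕ j))
      lower : sumFin (suc t) c * n ≤ x
      lower = subst (_≤ x) (sumFin-*ʳ (suc t) c n)
                (sumFin-mono-≤ (suc t) (λ j → *-monoʳ-≤ (c j) (m≤m+n n (toℕ j))))
      upper : x ≤ sumFin (suc t) c * (n + t)
      upper = subst (x ≤_) (sumFin-*ʳ (suc t) c (n + t))
                (sumFin-mono-≤ (suc t) (λ j → *-monoʳ-≤ (c j) (+-monoʳ-≤ n (≤-pred (toℕ<n j)))))

    InS-0 : InS n t 0
    InS-0 = (λ _ → 0) , sym (sumFin-zero (suc t))

    InS-+ : ∀ {x y} → InS n t x → InS n t y → InS n t (x + y)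
    InS-+ (c , refl) (d , refl) = (λ j → c j + d j) , sym (begin
        sumFin (suc t) (λ j → (c j + d j) * (n + toℕ j))
      ≡⟨ sumFin-cong (suc t) (λ j → *-distribʳ-+ (n + toℕ j) (c j) (d j)) ⟩
        sumFin (suc t) (λ j → c j * (n + toℕ j) + d j * (n + toℕ j))
      ≡⟨ sumFin-+ (suc t) (λ j → c j * (n + toℕ j)) (λ j → d j * (n + toℕ j)) ⟩
        sumFin (suc t) (λ j → c j * (n + toℕ j)) + sumFin (suc t) (λ j → d j * (n + toℕ j))
      ∎)
      where open ≡-Reasoning

    InS-generator : ∀ {i} → i ≤ t → InS n t (n + i)
    InS-generator i≤t = kronecker j , sym (trans (sumFin-kronecker (suc t) j (λ j → n + toℕ j))
                                                  (cong (n +_) (toℕ-fromℕ< (s≤s i≤t))))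
      where j = fromℕ< (s≤s i≤t)

    interval-step : ∀ s r → r ≤ suc s * t →
                    ∃ λ i → i ≤ t × ∃ λ r′ → r′ ≤ s * t × suc s * n + r ≡ n + i + (s * n + r′)
    interval-step s r r≤[1+s]t with r ≤? t
    ... | yes r≤t = r , r≤t , 0 , z≤n , rearrange s n r
      where
      rearrange : ∀ s n r → suc s * n + r ≡ n + r + (s * n + 0)
      rearrange = solve-∀
    ... | no  r≰t = t , ≤-refl , r ∸ t , r∸t≤st ,
                    trans (cong (suc s * n +_) (sym (m∸n+n≡m (≰⇒≥ r≰t)))) (rearrange s n (r ∸ t) t)
      where
      r∸t≤st : r ∸ t ≤ s * t
      r∸t≤st = subst (r ∸ t ≤_) (m+n∸m≡n t (s * t)) (∸-monoˡ-≤ t r≤[1+s]t)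
      rearrange : ∀ s n d t → suc s * n + (d + t) ≡ n + t + (s * n + d)
      rearrange = solve-∀

    InS-interval : ∀ s r → r ≤ s * t → InS n t (s * n + r)
    InS-interval zero    zero _         = InS-0
    InS-interval (suc s) r    r≤[1+s]t with interval-step s r r≤[1+s]t
    ... | i , i≤t , r′ , r′≤st , eq =
      subst (InS n t) (sym eq) (InS-+ (InS-generator i≤t) (InS-interval s r′ r′≤st))

    InIntervals⇒interval : ∀ {x} → InIntervals n t x → ∃ λ s → ∃ λ r → r ≤ s * t × x ≡ s * n + r
    InIntervals⇒interval {x} (s , sn≤x , x≤s[n+t]) = s , x ∸ s * n , r≤st , sym (m+[n∸m]≡n sn≤x)
      where
      r≤st = subst (x ∸ s * n ≤_) (m+n∸m≡n (s * n) (s * t))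
               (∸-monoˡ-≤ (s * n) (subst (x ≤_) (*-distribˡ-+ s n t) x≤s[n+t]))

    interval⇒InIntervals : ∀ s r → r ≤ s * t → InIntervals n t (s * n + r)
    interval⇒InIntervals s r r≤st =
      s , m≤m+n (s * n) r , subst (s * n + r ≤_) (sym (*-distribˡ-+ s n t)) (+-monoʳ-≤ (s * n) r≤st)

    InIntervals⇒InS : ∀ {x} → InIntervals n t x → InS n t x
    InIntervals⇒InS x∈I with InIntervals⇒interval x∈I
    ... | s , r , r≤st , refl = InS-interval s r r≤st

    InIntervals-+ : ∀ {x y} → InIntervals n t x → InIntervals n t y → InIntervals n t (x + y)
    InIntervals-+ {x} {y} (s , lx , ux) (s′ , ly , uy) =
      s + s′ , subst (_≤ x + y) (sym (*-distribʳ-+ n s s′)) (+-mono-≤ lx ly)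
             , subst (x + y ≤_) (sym (*-distribʳ-+ (n + t) s s′)) (+-mono-≤ ux uy)

    InIntervals-*ˡ : ∀ q {x} → InIntervals n t x → InIntervals n t (q * x)
    InIntervals-*ˡ q {x} (s , lx , ux) =
      q * s , subst (_≤ q * x) (sym (*-assoc q s n)) (*-monoʳ-≤ q lx)
            , subst (q * x ≤_) (sym (*-assoc q s (n + t))) (*-monoʳ-≤ q ux)

    InIntervals-residue : ∀ a k → k < n → InIntervals n t (a * n + k) ⇔ k ≤ a * t
    InIntervals-residue a k k<n = mk⇔ to (interval⇒InIntervals a k)
      where
      to : InIntervals n t (a * n + k) → k ≤ a * t
      to (s , sn≤x , x≤s[n+t]) with s ≤? a
      ... | yes s≤a = +-cancelˡ-≤ (a * n) k (a * t) (≤-trans x≤s[n+t] (begin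
              s * (n + t)      ≡⟨ *-distribˡ-+ s n t ⟩
              s * n + s * t    ≤⟨ +-mono-≤ (*-monoˡ-≤ n s≤a) (*-monoˡ-≤ t s≤a) ⟩
              a * n + a * t    ∎))
        where open ≤-Reasoning
      ... | no  s≰a = ⊥-elim (<⇒≱ (begin-strict
              a * n + k        <⟨ +-monoʳ-< (a * n) k<n ⟩
              a * n + n        ≡⟨ +-comm (a * n) n ⟩
              suc a * n        ≤⟨ *-monoˡ-≤ n (≰⇒> s≰a) ⟩
              s * n            ∎) sn≤x)
        where open ≤-Reasoning

    InIntervals-nonzero : ∀ {x} → InIntervals n t x → x ≢ 0 →
                          ∃ λ i → i ≤ t × ∃ λ x′ → InIntervals n t x′ × x ≡ n + i + x′
    InIntervals-nonzero x∈I x≢0 with InIntervals⇒interval x∈I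
    ... | zero  , r , r≤0 , refl = ⊥-elim (x≢0 (n≤0⇒n≡0 r≤0))
    ... | suc s , r , r≤[1+s]t , refl with interval-step s r r≤[1+s]t
    ...   | i , i≤t , r′ , r′≤st , eq = i , i≤t , s * n + r′ , interval⇒InIntervals s r′ r′≤st , eq

  InShiftedS : (q n t i m : ℕ) → Set
  InShiftedS q n t i m = ∃ λ y → InIntervals n t y × m ≡ q * (n + i) + y

  module _ {q n t : ℕ} where

    -- Every x ∈ S* is (n + i) + x′ with x′ ∈ S, and qS ⊆ S.
    InQSS⇔InShiftedS : .{{NonZero n}} → ∀ {m} → InQSS q n t m ⇔ (∃ λ i → i ≤ t × InShiftedS q n t i m)
    InQSS⇔InShiftedS = mk⇔ to from
      where
      to : ∀ {m} → InQSS q n t m → ∃ λ i → i ≤ t × InShiftedS q n t i m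
      to (x , y , x∈S , x≢0 , y∈S , refl) with InIntervals-nonzero (InS⇒InIntervals x∈S) x≢0
      ... | i , i≤t , x′ , x′∈I , refl =
        i , i≤t , q * x′ + y , InIntervals-+ (InIntervals-*ˡ q x′∈I) (InS⇒InIntervals y∈S) ,
        rearrange q n i x′ y
        where
        rearrange : ∀ q n i x′ y → q * (n + i + x′) + y ≡ q * (n + i) + (q * x′ + y)
        rearrange = solve-∀
      from : ∀ {m} → (∃ λ i → i ≤ t × InShiftedS q n t i m) → InQSS q n t m
      from (i , i≤t , y , y∈I , eq) =
        n + i , y , InS-generator i≤t , ≢-nonZero⁻¹ n ∘ m+n≡0⇒m≡0 n , InIntervals⇒InS y∈I , eq

    InQSS⇒InS : ∀ {m} → InQSS q n t m → InS n t m
    InQSS⇒InS (x , y , x∈S , _ , y∈S , refl) =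
      InIntervals⇒InS (InIntervals-+ (InIntervals-*ˡ q (InS⇒InIntervals x∈S)) (InS⇒InIntervals y∈S))

    InQSS⇒n≤ : .{{NonZero q}} → ∀ {m} → InQSS q n t m → n ≤ m
    InQSS⇒n≤ (x , y , x∈S , x≢0 , _ , refl) with InIntervals-nonzero (InS⇒InIntervals x∈S) x≢0
    ... | i , _ , x′ , _ , refl =
      ≤-trans (≤-trans (m≤m+n n i) (m≤m+n (n + i) x′)) (≤-trans (m≤n*m (n + i + x′) q) (m≤m+n _ y))

module _ where
  open import Data.Integer
    using (+_; -[1+_]; -_; 0ℤ; -1ℤ; _+_; _-_; _*_; _≤_; _<_; +≤+; +<+; -≤+; _/ℕ_; _%ℕ_; _⊓_; _≤?_)
  open import Data.Integer.Properties
  open import Data.Integer.DivMod using (a≡a%ℕn+[a/ℕn]*n; n%ℕd<d; n<s[n/ℕd]*d)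
  open import Data.Integer.Tactic.RingSolver using (solve-∀)
  open import Data.Nat.DivMod using (m<n⇒m%n≡m; m<n⇒m/n≡0)
  open import Level using (0ℓ)
  import Relation.Binary.Reasoning.Setoid as SetoidReasoning
  open import Function.Construct.Identity using (⇔-id)
  open import Data.Product.Function.NonDependent.Propositional using (_×-⇔_)
  open import Data.Product.Function.Dependent.Propositional using (congˡ)

  pos-*-+ : ∀ a n k → + (a ℕ.* n ℕ.+ k) ≡ + a * + n + + k
  pos-*-+ a n k = trans (pos-+ (a ℕ.* n) k) (cong (_+ + k) (pos-* a n))

  pos-≤-pos-* : ∀ k a t → + k ≤ + a * + t ⇔ k ℕ.≤ a ℕ.* t
  pos-≤-pos-* k a t = mk⇔ (λ h → drop‿+≤+ (subst (+ k ≤_) (sym (pos-* a t)) h))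
                          (λ h → subst (+ k ≤_) (pos-* a t) (+≤+ h))

  ≤⇔≤-of-≡-differences : ∀ {x y u v : ℤ} → y - x ≡ v - u → x ≤ y ⇔ u ≤ v
  ≤⇔≤-of-≡-differences eq =
    mk⇔ (λ x≤y → 0≤i-j⇒j≤i (subst (0ℤ ≤_) eq (i≤j⇒0≤j-i x≤y)))
        (λ u≤v → 0≤i-j⇒j≤i (subst (0ℤ ≤_) (sym eq) (i≤j⇒0≤j-i u≤v)))

  ≤-/ℕ⇔*-≤ : ∀ c y d .{{_ : NonZero d}} → c ≤ y /ℕ d ⇔ c * + d ≤ y
  ≤-/ℕ⇔*-≤ c y d = mk⇔ to from
    where
    to : c ≤ y /ℕ d → c * + d ≤ y
    to c≤y/d = ≤-trans (*-monoʳ-≤-nonNeg (+ d) c≤y/d)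
      (subst ((y /ℕ d) * + d ≤_) (sym (a≡a%ℕn+[a/ℕn]*n y d)) (i≤j+i _ (+ (y %ℕ d))))
    from : c * + d ≤ y → c ≤ y /ℕ d
    from cd≤y = subst (c ≤_) (pred-suc (y /ℕ d))
      (i<j⇒i≤pred[j] (*-cancelʳ-<-nonNeg {c} {ℤ.suc (y /ℕ d)} (+ d) (≤-<-trans cd≤y (n<s[n/ℕd]*d y d))))

  ceilDiv-≤⇔≤-* : ∀ x b d .{{_ : NonZero d}} → ceilDiv x d ≤ b ⇔ x ≤ b * + d
  ceilDiv-≤⇔≤-* x b d = ⇔.trans negated (⇔.trans (≤-/ℕ⇔*-≤ (- b) (- x) d) (mk⇔ to from))
    where
    negated : ceilDiv x d ≤ b ⇔ - b ≤ (- x) /ℕ d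
    negated = mk⇔ (λ h → subst (- b ≤_) (neg-involutive _) (neg-mono-≤ h))
                  (λ h → subst (ceilDiv x d ≤_) (neg-involutive b) (neg-mono-≤ h))
    to : - b * + d ≤ - x → x ≤ b * + d
    to h = neg-cancel-≤ (subst (_≤ - x) (sym (neg-distribˡ-* b (+ d))) h)
    from : x ≤ b * + d → - b * + d ≤ - x
    from h = subst (_≤ - x) (neg-distribˡ-* b (+ d)) (neg-mono-≤ h)

  0≤ceilDiv : ∀ x d .{{_ : NonZero d}} → 0ℤ ≤ ceilDiv (+ x) d
  0≤ceilDiv x d@(suc _) with 0ℤ ≤? ceilDiv (+ x) d
  ... | yes 0≤c = 0≤c
  ... | no  0≰c with () ← Equivalence.to (ceilDiv-≤⇔≤-* (+ x) -1ℤ d) (i<j⇒i≤pred[j] (≰⇒> 0≰c))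

  module ⇔-Reasoning = SetoidReasoning (⇔.⇔-setoid 0ℓ)

  m-[1+m]≡-1 : ∀ a → + a - + suc a ≡ -1ℤ
  m-[1+m]≡-1 a = cancel (+ a)
    where
    cancel : ∀ A → A - (+ 1 + A) ≡ -1ℤ
    cancel = solve-∀

  ∃-≡-+⇔∃-pos-≡ : ∀ (P : ℕ → Set) {M N : ℕ} {z : ℤ} → + M - + N ≡ z →
                  (∃ λ y → P y × M ≡ N ℕ.+ y) ⇔ (∃ λ y → P y × + y ≡ z)
  ∃-≡-+⇔∃-pos-≡ P {M} {N} {z} M-N≡z = mk⇔ to from
    where
    cancel : ∀ M N → M ≡ N + (M - N)
    cancel = solve-∀
    cancel′ : ∀ N Y → Y ≡ (N + Y) - N
    cancel′ = solve-∀
    to : (∃ λ y → P y × M ≡ N ℕ.+ y) → ∃ λ y → P y × + y ≡ z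
    to (y , p , refl) = y , p , trans (trans (cancel′ (+ N) (+ y)) (cong (_- + N) (sym (pos-+ N y)))) M-N≡z
    from : (∃ λ y → P y × + y ≡ z) → ∃ λ y → P y × M ≡ N ℕ.+ y
    from (y , p , y≡z) = y , p , +-injective (begin
      + M                 ≡⟨ cancel (+ M) (+ N) ⟩
      + N + (+ M - + N)   ≡⟨ cong (λ w → + N + w) (trans M-N≡z (sym y≡z)) ⟩
      + N + + y           ≡⟨ pos-+ N y ⟨
      + (N ℕ.+ y)         ∎)
      where open ≡-Reasoning

  ∃-pos-≡⇔ : ∀ (P : ℕ → Set) {m} → (∃ λ y → P y × + y ≡ + m) ⇔ P m
  ∃-pos-≡⇔ P {m} = mk⇔ (λ (y , p , y≡m) → subst P (+-injective y≡m) p) (λ p → m , p , refl)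

  quotient-nonneg : ∀ b {n r y} → r ℕ.< n → + y ≡ b * + n + + r → 0ℤ ≤ b
  quotient-nonneg b {n} {r} {y} r<n y≡bn+r =
    subst (0ℤ ≤_) (pred-suc b) (i<j⇒i≤pred[j] (*-cancelʳ-<-nonNeg {0ℤ} {ℤ.suc b} (+ n) 0<[1+b]n))
    where
    open ≤-Reasoning
    0<[1+b]n : 0ℤ * + n < ℤ.suc b * + n
    0<[1+b]n = begin-strict
      0ℤ * + n         ≡⟨ *-zeroˡ (+ n) ⟩
      0ℤ               ≤⟨ +≤+ z≤n ⟩
      + y              ≡⟨ y≡bn+r ⟩
      b * + n + + r    <⟨ +-monoʳ-< (b * + n) (+<+ r<n) ⟩
      b * + n + + n    ≡⟨ +-comm (b * + n) (+ n) ⟩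
      + n + b * + n    ≡⟨ suc-* b (+ n) ⟨
      ℤ.suc b * + n    ∎

  module _ {n t : ℕ} .{{_ : NonZero n}} .{{_ : NonZero t}} where

    InIntervals-residueℤ : ∀ b r → r ℕ.< n →
                           (∃ λ y → InIntervals n t y × + y ≡ b * + n + + r) ⇔ ceilDiv (+ r) t ≤ b
    InIntervals-residueℤ (+ c)    r r<n = begin
      (∃ λ y → InIntervals n t y × + y ≡ + c * + n + + r)  ≡⟨ cong (λ z → ∃ λ y → InIntervals n t y × + y ≡ z)
                                                                   (pos-*-+ c n r) ⟨
      (∃ λ y → InIntervals n t y × + y ≡ + (c ℕ.* n ℕ.+ r)) ≈⟨ ∃-pos-≡⇔ (InIntervals n t) ⟩
      InIntervals n t (c ℕ.* n ℕ.+ r)                       ≈⟨ InIntervals-residue c r r<n ⟩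
      r ℕ.≤ c ℕ.* t                                         ≈⟨ pos-≤-pos-* r c t ⟨
      + r ≤ + c * + t                                       ≈⟨ ceilDiv-≤⇔≤-* (+ r) (+ c) t ⟨
      ceilDiv (+ r) t ≤ + c                                 ∎
      where open ⇔-Reasoning
    InIntervals-residueℤ -[1+ c ] r r<n =
      mk⇔ (λ (_ , _ , y≡bn+r) → contradiction (quotient-nonneg -[1+ c ] r<n y≡bn+r) λ ())
          (λ ⌈r/t⌉≤b → contradiction (≤-trans (0≤ceilDiv r t) ⌈r/t⌉≤b) λ ())

  ⊓-≤⇔ : ∀ i j k → i ⊓ j ≤ k ⇔ (i ≤ k ⊎ j ≤ k)
  ⊓-≤⇔ i j k = mk⇔ to from
    where
    to : i ⊓ j ≤ k → i ≤ k ⊎ j ≤ k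
    to h with ⊓-sel i j
    ... | inj₁ i⊓j≡i = inj₁ (subst (_≤ k) i⊓j≡i h)
    ... | inj₂ i⊓j≡j = inj₂ (subst (_≤ k) i⊓j≡j h)
    from : i ≤ k ⊎ j ≤ k → i ⊓ j ≤ k
    from (inj₁ i≤k) = ≤-trans (i⊓j≤i i j) i≤k
    from (inj₂ j≤k) = ≤-trans (i⊓j≤j i j) j≤k

  -- The leading q of the minimum plays the role of the index i = 0.
  minOver-≤⇔ : ∀ q (f : ℕ → ℤ) x J → f 0 ≡ + q → minOver q f J ≤ x ⇔ (∃ λ i → i ℕ.≤ J × f i ≤ x)
  minOver-≤⇔ q f x zero    f0≡q =
    mk⇔ (λ q≤x → 0 , z≤n , subst (_≤ x) (sym f0≡q) q≤x) (λ { (_ , z≤n , f0≤x) → subst (_≤ x) f0≡q f0≤x })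
  minOver-≤⇔ q f x (suc J) f0≡q = ⇔.trans (⊓-≤⇔ (minOver q f J) (f (suc J)) x) (mk⇔ to from)
    where
    IH = minOver-≤⇔ q f x J f0≡q
    to : minOver q f J ≤ x ⊎ f (suc J) ≤ x → ∃ λ i → i ℕ.≤ suc J × f i ≤ x
    to (inj₁ h) with Equivalence.to IH h
    ... | i , i≤J , fi≤x = i , ℕₚ.m≤n⇒m≤1+n i≤J , fi≤x
    to (inj₂ h) = suc J , ℕₚ.≤-refl , h
    from : (∃ λ i → i ℕ.≤ suc J × f i ≤ x) → minOver q f J ≤ x ⊎ f (suc J) ≤ x
    from (i , i≤1+J , fi≤x) with ℕₚ.m≤n⇒m<n∨m≡n i≤1+J
    ... | inj₁ (s≤s i≤J) = inj₁ (Equivalence.from IH (i , i≤J , fi≤x))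
    ... | inj₂ refl      = inj₂ fi≤x

  module Residue (q n t k : ℕ) .{{_ : NonZero n}} .{{_ : NonZero t}} where

    α : ℤ
    α = ceilDiv (+ k) t

    InS-residue : k ℕ.< n → ∀ a → InS n t (a ℕ.* n ℕ.+ k) ⇔ α ≤ + a
    InS-residue k<n a = begin
      InS n t (a ℕ.* n ℕ.+ k)           ≈⟨ mk⇔ InS⇒InIntervals InIntervals⇒InS ⟩
      InIntervals n t (a ℕ.* n ℕ.+ k)   ≈⟨ InIntervals-residue a k k<n ⟩
      k ℕ.≤ a ℕ.* t                     ≈⟨ pos-≤-pos-* k a t ⟨
      + k ≤ + a * + t                   ≈⟨ ceilDiv-≤⇔≤-* (+ k) (+ a) t ⟨
      α ≤ + a                           ∎
      where open ⇔-Reasoning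

    module Generator (i : ℕ) where
      e : ℤ
      e = + k - + (i ℕ.* q)
      kᵢ : ℕ
      kᵢ = e %ℕ n
      j : ℤ
      j = e /ℕ n
      γ : ℤ
      γ = ceilDiv (+ kᵢ) t

      C≡ : C q n t k i ≡ + q - α + γ - j
      C≡ = cong (λ z → + q - α + γ - (z /ℕ n)) (neg-sub (+ (i ℕ.* q)) (+ k))
        where
        neg-sub : ∀ x y → - (x - y) ≡ y - x
        neg-sub = solve-∀

      difference : ∀ a → + (a ℕ.* n ℕ.+ k) - + (q ℕ.* (n ℕ.+ i)) ≡ (+ a - + q + j) * + n + + kᵢ
      difference a = begin
          + (a ℕ.* n ℕ.+ k) - + (q ℕ.* (n ℕ.+ i))
        ≡⟨ cong₂ _-_ (pos-*-+ a n k) (trans (pos-* q (n ℕ.+ i)) (cong (+ q *_) (pos-+ n i))) ⟩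
          + a * + n + + k - + q * (+ n + + i)
        ≡⟨ expand (+ a) (+ n) (+ k) (+ q) (+ i) ⟩
          (+ a - + q) * + n + (+ k - + i * + q)
        ≡⟨ cong (λ z → (+ a - + q) * + n + (+ k - z)) (pos-* i q) ⟨
          (+ a - + q) * + n + e
        ≡⟨ cong (λ z → (+ a - + q) * + n + z) (a≡a%ℕn+[a/ℕn]*n e n) ⟩
          (+ a - + q) * + n + (+ kᵢ + j * + n)
        ≡⟨ collect (+ a) (+ q) (+ n) (+ kᵢ) j ⟩
          (+ a - + q + j) * + n + + kᵢ
        ∎
        where
        open ≡-Reasoning
        expand : ∀ A N K Q I → A * N + K - Q * (N + I) ≡ (A - Q) * N + (K - I * Q)
        expand = solve-∀
        collect : ∀ A Q N R J → (A - Q) * N + (R + J * N) ≡ (A - Q + J) * N + R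
        collect = solve-∀

    C-zero : k ℕ.< n → C q n t k 0 ≡ + q
    C-zero k<n = begin
        C q n t k 0              ≡⟨ C≡ ⟩
        + q - α + γ - j          ≡⟨ cong₂ (λ g z → + q - α + g - z) γ≡α j≡0 ⟩
        + q - α + α - + 0        ≡⟨ cancel (+ q) α ⟩
        + q                      ∎
      where
      open ≡-Reasoning
      open Generator 0
      e≡k : e ≡ + k
      e≡k = +-identityʳ (+ k)
      γ≡α : γ ≡ α
      γ≡α = cong (λ z → ceilDiv (+ z) t) (trans (cong (_%ℕ n) e≡k) (m<n⇒m%n≡m k<n))
      j≡0 : j ≡ + 0
      j≡0 = trans (cong (_/ℕ n) e≡k) (cong +_ (m<n⇒m/n≡0 k<n))
      cancel : ∀ Q A → Q - A + A - + 0 ≡ Q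
      cancel = solve-∀

    InShiftedS-residue : ∀ i a → InShiftedS q n t i (a ℕ.* n ℕ.+ k) ⇔ C q n t k i ≤ + a - α
    InShiftedS-residue i a = begin
      InShiftedS q n t i (a ℕ.* n ℕ.+ k)                   ≈⟨ ∃-≡-+⇔∃-pos-≡ (InIntervals n t) (difference a) ⟩
      (∃ λ y → InIntervals n t y × + y ≡ b * + n + + kᵢ)   ≈⟨ InIntervals-residueℤ b kᵢ (n%ℕd<d e n) ⟩
      γ ≤ b                                                ≈⟨ ≤⇔≤-of-≡-differences b-γ≡a-α-C ⟩
      C q n t k i ≤ + a - α                                ∎
      where
      open ⇔-Reasoning
      open Generator i
      b = + a - + q + j
      b-γ≡a-α-C : b - γ ≡ + a - α - C q n t k i
      b-γ≡a-α-C = trans (rearrange (+ a) (+ q) j γ α) (cong (λ c → + a - α - c) (sym C≡))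
        where
        rearrange : ∀ A Q J G Al → A - Q + J - G ≡ A - Al - (Q - Al + G - J)
        rearrange = solve-∀

    μ : ℤ
    μ = minOver q (λ i → C q n t k i) t

    InQSS-residue : k ℕ.< n → ∀ a → InQSS q n t (a ℕ.* n ℕ.+ k) ⇔ μ ≤ + a - α
    InQSS-residue k<n a = begin
      InQSS q n t (a ℕ.* n ℕ.+ k)
        ≈⟨ InQSS⇔InShiftedS {q} ⟩
      (∃ λ i → i ℕ.≤ t × InShiftedS q n t i (a ℕ.* n ℕ.+ k))
        ≈⟨ congˡ (⇔-id _ ×-⇔ InShiftedS-residue _ a) ⟩
      (∃ λ i → i ℕ.≤ t × C q n t k i ≤ + a - α)
        ≈⟨ minOver-≤⇔ q (λ i → C q n t k i) (+ a - α) t (C-zero k<n) ⟨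
      μ ≤ + a - α
        ∎
      where open ⇔-Reasoning

    α′ : ℕ
    α′ = ℤ.∣ α ∣

    +α′≡α : + α′ ≡ α
    +α′≡α = 0≤i⇒+∣i∣≡i (0≤ceilDiv k t)

    -- If μ < 0, then a n + k ∈ qS* + S for a = max (⌈k/t⌉ - 1) 0, contradicting qS* + S ⊆ S ∩ [n, ∞).
    0≤μ : .{{NonZero q}} → k ℕ.< n → 0ℤ ≤ μ
    0≤μ k<n with 0ℤ ≤? μ
    ... | yes 0≤μ = 0≤μ
    ... | no  0≰μ = ⊥-elim (impossible α′ +α′≡α)
      where
      μ≤-1 : μ ≤ -1ℤ
      μ≤-1 = i<j⇒i≤pred[j] (≰⇒> 0≰μ)
      impossible : ∀ a → + a ≡ α → ⊥
      impossible zero    0≡α = ℕₚ.<⇒≱ k<n (InQSS⇒n≤ {q} (Equivalence.from (InQSS-residue k<n 0) μ≤0-α))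
        where
        μ≤0-α : μ ≤ + 0 - α
        μ≤0-α = ≤-trans μ≤-1 (subst (λ z → -1ℤ ≤ + 0 - z) 0≡α -≤+)
      impossible (suc a) 1+a≡α = ℕₚ.n≮n a (drop‿+≤+ (subst (_≤ + a) (sym 1+a≡α)
        (Equivalence.to (InS-residue k<n a) (InQSS⇒InS {q} (Equivalence.from (InQSS-residue k<n a) μ≤a-α)))))
        where
        μ≤a-α : μ ≤ + a - α
        μ≤a-α = ≤-trans μ≤-1 (≤-reflexive (sym (trans (cong (λ z → + a - z) (sym 1+a≡α)) (m-[1+m]≡-1 a))))

    μ′ : ℕ
    μ′ = ℤ.∣ μ ∣

    +μ′≡μ : .{{NonZero q}} → k ℕ.< n → + μ′ ≡ μ
    +μ′≡μ k<n = 0≤i⇒+∣i∣≡i (0≤μ k<n)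

    InGM-residue : .{{NonZero q}} → k ℕ.< n → ∀ a → InGM q n t (a ℕ.* n ℕ.+ k) ⇔ (α′ ℕ.≤ a × a ℕ.< α′ ℕ.+ μ′)
    InGM-residue k<n a =
      mk⇔ (λ (x∈S , x∉Q) → Equivalence.to InS-bound x∈S , ℕₚ.≰⇒> (x∉Q ∘ Equivalence.from InQSS-bound))
          (λ (lower , upper) → Equivalence.from InS-bound lower , ℕₚ.<⇒≱ upper ∘ Equivalence.to InQSS-bound)
      where
      open ⇔-Reasoning
      InS-bound : InS n t (a ℕ.* n ℕ.+ k) ⇔ α′ ℕ.≤ a
      InS-bound = begin
        InS n t (a ℕ.* n ℕ.+ k)   ≈⟨ InS-residue k<n a ⟩
        α ≤ + a                   ≡⟨ cong (_≤ + a) +α′≡α ⟨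
        + α′ ≤ + a                ≈⟨ mk⇔ drop‿+≤+ +≤+ ⟩
        α′ ℕ.≤ a                  ∎
      InQSS-bound : InQSS q n t (a ℕ.* n ℕ.+ k) ⇔ α′ ℕ.+ μ′ ℕ.≤ a
      InQSS-bound = begin
        InQSS q n t (a ℕ.* n ℕ.+ k)   ≈⟨ InQSS-residue k<n a ⟩
        μ ≤ + a - α                   ≡⟨ cong₂ (λ u v → u ≤ + a - v) (+μ′≡μ k<n) +α′≡α ⟨
        + μ′ ≤ + a - + α′             ≈⟨ ≤⇔≤-of-≡-differences difference ⟩
        + (α′ ℕ.+ μ′) ≤ + a           ≈⟨ mk⇔ drop‿+≤+ +≤+ ⟩
        α′ ℕ.+ μ′ ℕ.≤ a               ∎
        where
        regroup : ∀ A B M → A - B - M ≡ A - (B + M)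
        regroup = solve-∀
        difference : + a - + α′ - + μ′ ≡ + a - + (α′ ℕ.+ μ′)
        difference = trans (regroup (+ a) (+ α′) (+ μ′)) (cong (λ z → + a - z) (sym (pos-+ α′ μ′)))

module _ (q n t : ℕ) .{{_ : NonZero q}} .{{_ : NonZero n}} .{{_ : NonZero t}} where
  open import Data.Nat using (_+_; _*_; _∸_; _≤_; _<_; _≟_)
  open import Data.Nat.Properties
  open import Data.Nat.DivMod using (_%_; _/_; m≡m%n+[m/n]*n; m<n⇒m%n≡m; [m+kn]%n≡m%n)
  open import Data.List.Properties using (length-++; length-applyUpTo)
  open import Data.List.Membership.Propositional.Properties
    using (∈-applyUpTo⁺; ∈-applyUpTo⁻; ∈-++⁺ˡ; ∈-++⁺ʳ; ∈-++⁻)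
  open import Data.List.Relation.Unary.AllPairs using ([])
  import Data.List.Relation.Unary.Unique.Propositional.Properties as Unique
  open import Data.Integer using (+_) renaming (_+_ to _+ℤ_)
  open Residue q n t using (α′; μ; μ′; +μ′≡μ; InGM-residue)

  residueBlock : ℕ → List ℕ
  residueBlock k = applyUpTo (λ u → (α′ k + u) * n + k) (μ′ k)

  [a*n+k]%n≡k : ∀ a {k} → k < n → (a * n + k) % n ≡ k
  [a*n+k]%n≡k a {k} k<n = trans (cong (_% n) (+-comm (a * n) k)) (trans ([m+kn]%n≡m%n k a n) (m<n⇒m%n≡m k<n))

  ∈-residueBlock⇔ : ∀ {k m} → k < n → m ∈ residueBlock k ⇔ (m % n ≡ k × InGM q n t m)
  ∈-residueBlock⇔ {k} {m} k<n = mk⇔ to from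
    where
    to : m ∈ residueBlock k → m % n ≡ k × InGM q n t m
    to m∈B with ∈-applyUpTo⁻ (λ u → (α′ k + u) * n + k) m∈B
    ... | u , u<μ′ , refl =
      [a*n+k]%n≡k (α′ k + u) k<n ,
      Equivalence.from (InGM-residue k k<n (α′ k + u)) (m≤m+n (α′ k) u , +-monoʳ-< (α′ k) u<μ′)
    from : m % n ≡ k × InGM q n t m → m ∈ residueBlock k
    from (refl , m∈GM) = subst (_∈ residueBlock k) (sym m≡) (∈-applyUpTo⁺ (λ u → (α′ k + u) * n + k) u<μ′)
      where
      a = m / n
      m≡an+k : m ≡ a * n + k
      m≡an+k = trans (m≡m%n+[m/n]*n m n) (+-comm (m % n) (a * n))
      bounds = Equivalence.to (InGM-residue k k<n a) (subst (InGM q n t) m≡an+k m∈GM)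
      u = a ∸ α′ k
      α′+u≡a : α′ k + u ≡ a
      α′+u≡a = m+[n∸m]≡n (proj₁ bounds)
      u<μ′ : u < μ′ k
      u<μ′ = +-cancelˡ-< (α′ k) u (μ′ k) (subst (_< α′ k + μ′ k) (sym α′+u≡a) (proj₂ bounds))
      m≡ : m ≡ (α′ k + u) * n + k
      m≡ = trans m≡an+k (cong (λ z → z * n + k) (sym α′+u≡a))

  residueBlock-unique : ∀ k → Unique (residueBlock k)
  residueBlock-unique k = Unique.applyUpTo⁺₁ _ (μ′ k) (λ i<j _ eq → <⇒≢ i<j (injective eq))
    where
    injective : ∀ {u v} → (α′ k + u) * n + k ≡ (α′ k + v) * n + k → u ≡ v
    injective {u} {v} eq = +-cancelˡ-≡ (α′ k) u v (*-cancelʳ-≡ (α′ k + u) (α′ k + v) n (+-cancelʳ-≡ k _ _ eq))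

  gmElements : ℕ → List ℕ
  gmElements zero    = []
  gmElements (suc K) = gmElements K ++ residueBlock K

  ∈-gmElements⇔ : ∀ {K m} → K ≤ n → m ∈ gmElements K ⇔ (m % n < K × InGM q n t m)
  ∈-gmElements⇔ {zero}  _    = mk⇔ (λ ()) (λ ())
  ∈-gmElements⇔ {suc K} {m} K<n = mk⇔ to from
    where
    IH = ∈-gmElements⇔ {K} (<⇒≤ K<n)
    to : m ∈ gmElements (suc K) → m % n < suc K × InGM q n t m
    to m∈ with ∈-++⁻ (gmElements K) m∈
    ... | inj₁ m∈E = let (m%n<K , m∈GM) = Equivalence.to IH m∈E in m≤n⇒m≤1+n m%n<K , m∈GM
    ... | inj₂ m∈B = let (m%n≡K , m∈GM) = Equivalence.to (∈-residueBlock⇔ K<n) m∈B in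
                     s≤s (≤-reflexive m%n≡K) , m∈GM
    from : m % n < suc K × InGM q n t m → m ∈ gmElements (suc K)
    from (m%n≤K , m∈GM) with m % n ≟ K
    ... | yes m%n≡K = ∈-++⁺ʳ (gmElements K) (Equivalence.from (∈-residueBlock⇔ K<n) (m%n≡K , m∈GM))
    ... | no  m%n≢K = ∈-++⁺ˡ (Equivalence.from IH (≤∧≢⇒< (≤-pred m%n≤K) m%n≢K , m∈GM))

  gmElements-unique : ∀ {K} → K ≤ n → Unique (gmElements K)
  gmElements-unique {zero}  _   = []
  gmElements-unique {suc K} K<n = Unique.++⁺ (gmElements-unique (<⇒≤ K<n)) (residueBlock-unique K) disjoint
    where
    disjoint : ∀ {m} → ¬ (m ∈ gmElements K × m ∈ residueBlock K)
    disjoint (m∈E , m∈B) = <-irrefl (proj₁ (Equivalence.to (∈-residueBlock⇔ K<n) m∈B))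
                                    (proj₁ (Equivalence.to (∈-gmElements⇔ (<⇒≤ K<n)) m∈E))

  length-gmElements : ∀ {K} → K ≤ n → + length (gmElements K) ≡ sumℤ K (λ k → μ k)
  length-gmElements {zero}  _   = refl
  length-gmElements {suc K} K<n = begin
      + length (gmElements K ++ residueBlock K)
    ≡⟨ cong +_ (length-++ (gmElements K)) ⟩
      + (length (gmElements K) + length (residueBlock K))
    ≡⟨ ℤₚ.pos-+ (length (gmElements K)) (length (residueBlock K)) ⟩
      + length (gmElements K) +ℤ + length (residueBlock K)
    ≡⟨ cong₂ _+ℤ_ (length-gmElements (<⇒≤ K<n)) (trans (cong +_ (length-applyUpTo _ (μ′ K))) (+μ′≡μ K K<n)) ⟩
      sumℤ K (λ k → μ k) +ℤ μ K
    ∎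
    where open ≡-Reasoning

open import Data.Integer using (+_; _+_)

theorem4p1 : (q n t : ℕ) → .{{_ : NonZero q}} → .{{_ : NonZero n}} → .{{_ : NonZero t}} →
    1 ℕ.≤ t → t ℕ.< n →
    Σ (List ℕ) λ L → Unique L × (∀ m → (m ∈ L ⇔ InGM q n t m)) ×
      (+ (length L) + + 1 ≡ + 1 + sumℤ n (λ k → minOver q (λ i → C q n t k i) t))
theorem4p1 q n t _ _ = gmElements q n t n , gmElements-unique q n t ℕₚ.≤-refl , membership , size
  where
  open import Data.Nat.DivMod using (m%n<n)
  membership : ∀ m → m ∈ gmElements q n t n ⇔ InGM q n t m
  membership m = ⇔.trans (∈-gmElements⇔ q n t ℕₚ.≤-refl) (mk⇔ proj₂ (m%n<n m n ,_))
  Σμ = sumℤ n (λ k → minOver q (λ i → C q n t k i) t)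
  size : + length (gmElements q n t n) + + 1 ≡ + 1 + Σμ
  size = trans (cong (_+ + 1) (length-gmElements q n t ℕₚ.≤-refl)) (ℤₚ.+-comm Σμ (+ 1))
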